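{- Let $b,c\in\mathbb{Z}$ and $d=b^2-4c$, and for $n\in\mathbb{N}$ let $T_n(b,c)=\sum_{k=0}^{\lfloor n/2\rfloor}\binom n{2k}\binom{2k}k b^{n-2k}c^k$. For every $n\in\mathbb{N}$, $$T_n(b,c)^2=\sum_{k=0}^n\binom{n+k}{2k}\binom{2k}k^2c^kd^{n-k}.$$ -}

module Defs where

open import Data.Nat as ℕ using (ℕ; zero; suc; _/_)
open import Data.Nat.Combinatorics using (_C_)
open import Data.Integer using (ℤ; +_; _+_; _*_; _-_; _^_)

sumTo : ℕ → (ℕ → ℤ) → ℤ
sumTo zero    f = f zero
sumTo (suc n) f = sumTo n f + f (suc n)

disc : ℤ → ℤ → ℤ
disc b c = b * b - (+ 4) * c

T : ℕ → ℤ → ℤ → ℤ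
T n b c = sumTo (n / 2) (λ k →
  (+ (n C (2 ℕ.* k))) * (+ ((2 ℕ.* k) C k)) * (b ^ (n ℕ.∸ 2 ℕ.* k)) * (c ^ k))

module Submission where

-- Write d = b² − 4c and
--   T_n = Σ_k t(n,k) b^{n−2k} cᵏ,   t(n,k) = C(n,2k) C(2k,k),
--   S_n = Σ_k s(n,k) cᵏ d^{n−k},    s(n,k) = C(n+k,2k) C(2k,k)²,
--   G_n = Σ_k g(n,k) cᵏ d^{n−k},    g(n,k) = (n+k+1) s(n,k).  The three sequences satisfy the recurrences
--   (R)  (n+2) T_{n+2} = (2n+3) b T_{n+1} − (n+1) d T_n,
--   (Q₁) G_{n+1}       = (2n+3) S_{n+1} − d G_n,
--   (Q₂) (n+2)² S_{n+2} = (2n+3)² b² S_{n+1} − 2(2n+3) b² d G_n + (n+1)² d² S_n,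
-- and a ring computation then propagates the invariant
--   T_n² = S_n,   T_{n+1}² = S_{n+1},   (n+1) T_n T_{n+1} = b G_n
-- from n to n+1.  The file develops: finite and weighted sums, where multiplying by b, c
-- or d only moves the weights; falling factorials, which turn t(n,k)·k!² and s(n,k)·k!⁴
-- into polynomials in n; from these the recurrences of the coefficients t, g, s; the sum
-- recurrences (R), (Q₁), (Q₂); and finally the induction.

open import Defs
open import Data.Nat as ℕ using (ℕ)
open import Data.Nat.Combinatorics using (_C_)
open import Data.Integer using (ℤ; +_; _*_; _^_)
open import Relation.Binary.PropositionalEquality using (_≡_)

open import Data.Nat.Base using (zero; suc; _!)
import Data.Nat.Properties as ℕP
import Data.Nat.DivMod as ℕDM
open import Data.Nat.Combinatorics using (nCk+nC[k+1]≡[n+1]C[k+1]; k>n⇒nCk≡0)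
open import Data.Integer.Base using (_+_; _-_; -_; 0ℤ; NonZero)
import Data.Integer.Properties as ℤP
open import Data.Integer.Tactic.RingSolver using (solve-∀)
open import Data.Product using (_×_; _,_; proj₁)
open import Relation.Binary.PropositionalEquality
  using (refl; sym; trans; cong; cong₂; subst; module ≡-Reasoning)
open import Relation.Nullary using (yes; no)
open import Relation.Nullary.Negation using (contradiction)

open ≡-Reasoning

sumTo-cong : ∀ n {f g : ℕ → ℤ} → (∀ k → k ℕ.≤ n → f k ≡ g k) → sumTo n f ≡ sumTo n g
sumTo-cong zero    f≗g = f≗g 0 ℕ.z≤n
sumTo-cong (suc n) f≗g =
  cong₂ _+_ (sumTo-cong n (λ k k≤n → f≗g k (ℕP.m≤n⇒m≤1+n k≤n))) (f≗g (suc n) ℕP.≤-refl)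

sumTo-+ : ∀ n (f g : ℕ → ℤ) → sumTo n f + sumTo n g ≡ sumTo n (λ k → f k + g k)
sumTo-+ zero    f g = refl
sumTo-+ (suc n) f g =
  trans (interchange (sumTo n f) (f (suc n)) (sumTo n g) (g (suc n)))
        (cong (_+ (f (suc n) + g (suc n))) (sumTo-+ n f g))
  where
  interchange : ∀ w x y z → (w + x) + (y + z) ≡ (w + y) + (x + z)
  interchange = solve-∀

sumTo-scale : ∀ n a (f : ℕ → ℤ) → a * sumTo n f ≡ sumTo n (λ k → a * f k)
sumTo-scale zero    a f = refl
sumTo-scale (suc n) a f =
  trans (ℤP.*-distribˡ-+ a _ _) (cong (_+ a * f (suc n)) (sumTo-scale n a f))

sumTo-unshift : ∀ n (f : ℕ → ℤ) → sumTo (suc n) f ≡ f 0 + sumTo n (λ k → f (suc k))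
sumTo-unshift zero    f = refl
sumTo-unshift (suc n) f =
  trans (cong (_+ f (suc (suc n))) (sumTo-unshift n f)) (ℤP.+-assoc (f 0) _ _)

sumTo-pad : ∀ n e (f : ℕ → ℤ) → (∀ k → n ℕ.< k → f k ≡ 0ℤ) → sumTo (e ℕ.+ n) f ≡ sumTo n f
sumTo-pad n zero    f vanish = refl
sumTo-pad n (suc e) f vanish =
  trans (cong (λ x → sumTo (e ℕ.+ n) f + x) (vanish (suc (e ℕ.+ n)) (ℕ.s≤s (ℕP.m≤n+m n e))))
        (trans (ℤP.+-identityʳ _) (sumTo-pad n e f vanish))

module Weighted (w : ℕ → ℕ → ℤ) where

  Σw : ℕ → (ℕ → ℤ) → ℤ
  Σw n f = sumTo n (λ k → f k * w n k)

  Σw-cong : ∀ n {f g : ℕ → ℤ} → (∀ k → f k ≡ g k) → Σw n f ≡ Σw n g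
  Σw-cong n {f} {g} f≗g = sumTo-cong n (λ k _ → cong (_* w n k) (f≗g k))

  Σw-scale : ∀ n α (f : ℕ → ℤ) → α * Σw n f ≡ Σw n (λ k → α * f k)
  Σw-scale n α f =
    trans (sumTo-scale n α _) (sumTo-cong n (λ k _ → sym (ℤP.*-assoc α (f k) (w n k))))

  Σw-axpy : ∀ n (F : ℕ → ℤ) α (f : ℕ → ℤ) → Σw n F + α * Σw n f ≡ Σw n (λ k → F k + α * f k)
  Σw-axpy n F α f =
    trans (cong (λ x → Σw n F + x) (Σw-scale n α f))
      (trans (sumTo-+ n _ _) (sumTo-cong n (λ k _ → sym (ℤP.*-distribʳ-+ (w n k) (F k) (α * f k)))))

  Σw-lin₂ : ∀ n α (f : ℕ → ℤ) β (g : ℕ → ℤ) → α * Σw n f + β * Σw n g ≡ Σw n (λ k → α * f k + β * g k)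
  Σw-lin₂ n α f β g = trans (cong (_+ β * Σw n g) (Σw-scale n α f)) (Σw-axpy n (λ k → α * f k) β g)

  Σw-lin₃ : ∀ n α (f : ℕ → ℤ) β (g : ℕ → ℤ) γ (h : ℕ → ℤ) →
    α * Σw n f + β * Σw n g + γ * Σw n h ≡ Σw n (λ k → α * f k + β * g k + γ * h k)
  Σw-lin₃ n α f β g γ h = trans (cong (_+ γ * Σw n h) (Σw-lin₂ n α f β g)) (Σw-axpy n (λ k → α * f k + β * g k) γ h)

  Σw-lin₅ : ∀ n α₁ (f₁ : ℕ → ℤ) α₂ (f₂ : ℕ → ℤ) α₃ (f₃ : ℕ → ℤ) α₄ (f₄ : ℕ → ℤ) α₅ (f₅ : ℕ → ℤ) →
    α₁ * Σw n f₁ + α₂ * Σw n f₂ + α₃ * Σw n f₃ + α₄ * Σw n f₄ + α₅ * Σw n f₅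
      ≡ Σw n (λ k → α₁ * f₁ k + α₂ * f₂ k + α₃ * f₃ k + α₄ * f₄ k + α₅ * f₅ k)
  Σw-lin₅ n α₁ f₁ α₂ f₂ α₃ f₃ α₄ f₄ α₅ f₅ =
    trans (cong (λ x → x + α₄ * Σw n f₄ + α₅ * Σw n f₅) (Σw-lin₃ n α₁ f₁ α₂ f₂ α₃ f₃))
      (trans (cong (_+ α₅ * Σw n f₅) (Σw-axpy n (λ k → α₁ * f₁ k + α₂ * f₂ k + α₃ * f₃ k) α₄ f₄))
             (Σw-axpy n (λ k → α₁ * f₁ k + α₂ * f₂ k + α₃ * f₃ k + α₄ * f₄ k) α₅ f₅))

-- The coefficient sequence of c·Σ: every coefficient moves up one place.
shift : (ℕ → ℤ) → ℕ → ℤ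
shift f zero    = 0ℤ
shift f (suc k) = f k

VanishesAbove : ℕ → (ℕ → ℤ) → Set
VanishesAbove n f = ∀ k → n ℕ.< k → f k ≡ 0ℤ

VanishesAboveHalf : ℕ → (ℕ → ℤ) → Set
VanishesAboveHalf n f = ∀ k → n ℕ.< 2 ℕ.* k → f k ≡ 0ℤ

n<k⇒n<2k : ∀ {n k} → n ℕ.< k → n ℕ.< 2 ℕ.* k
n<k⇒n<2k {k = k} n<k = ℕP.<-≤-trans n<k (ℕP.m≤m+n k _)

vanishesAbove-suc : ∀ {n f} → VanishesAbove n f → VanishesAbove (suc n) f
vanishesAbove-suc vanish k n+1<k = vanish k (ℕP.<-trans (ℕP.n<1+n _) n+1<k)

vanishesAboveHalf-suc : ∀ {n f} → VanishesAboveHalf n f → VanishesAboveHalf (suc n) f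
vanishesAboveHalf-suc vanish k n+1<2k = vanish k (ℕP.<-trans (ℕP.n<1+n _) n+1<2k)

2*suc : ∀ k → 2 ℕ.* suc k ≡ suc (suc (2 ℕ.* k))
2*suc k = cong suc (ℕP.+-suc k (k ℕ.+ 0))

module Weights (b c : ℤ) where

  d : ℤ
  d = disc b c

  module B = Weighted (λ n k → b ^ (n ℕ.∸ 2 ℕ.* k) * c ^ k)
  module D = Weighted (λ n k → c ^ k * d ^ (n ℕ.∸ k))

  -- Multiplying by b raises every exponent n − 2k, which is harmless where 2k > n
  -- because the coefficient vanishes there.
  b-step : ∀ n (f : ℕ → ℤ) → VanishesAboveHalf n f → b * B.Σw n f ≡ B.Σw (suc n) f
  b-step n f vanish = begin
      b * B.Σw n f
    ≡⟨ sumTo-scale n b _ ⟩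
      sumTo n (λ k → b * (f k * (b ^ (n ℕ.∸ 2 ℕ.* k) * c ^ k)))
    ≡⟨ sumTo-cong n (λ k _ → raise k) ⟩
      sumTo n (λ k → f k * (b ^ (suc n ℕ.∸ 2 ℕ.* k) * c ^ k))
    ≡⟨ sym (sumTo-pad n 1 _ (λ k n<k → cong (_* _) (vanish k (n<k⇒n<2k n<k)))) ⟩
      B.Σw (suc n) f ∎
    where
    move : ∀ b x p q → b * (x * (p * q)) ≡ x * (b * p * q)
    move = solve-∀
    raise : ∀ k → b * (f k * (b ^ (n ℕ.∸ 2 ℕ.* k) * c ^ k)) ≡ f k * (b ^ (suc n ℕ.∸ 2 ℕ.* k) * c ^ k)
    raise k with 2 ℕ.* k ℕ.≤? n
    ... | yes 2k≤n rewrite ℕP.+-∸-assoc 1 2k≤n = move b (f k) (b ^ (n ℕ.∸ 2 ℕ.* k)) (c ^ k)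
    ... | no 2k≰n rewrite vanish k (ℕP.≰⇒> 2k≰n) = ℤP.*-zeroʳ b

  c-step-B : ∀ n (f : ℕ → ℤ) → VanishesAboveHalf n f → c * B.Σw n f ≡ B.Σw (suc (suc n)) (shift f)
  c-step-B n f vanish = begin
      c * B.Σw n f
    ≡⟨ sumTo-scale n c _ ⟩
      sumTo n (λ k → c * (f k * (b ^ (n ℕ.∸ 2 ℕ.* k) * c ^ k)))
    ≡⟨ sumTo-cong n (λ k _ → raise k) ⟩
      sumTo n (λ k → term (suc k))
    ≡⟨ sym (trans (sumTo-unshift n term) (ℤP.+-identityˡ _)) ⟩
      sumTo (suc n) term
    ≡⟨ sym (sumTo-pad (suc n) 1 term top) ⟩
      B.Σw (suc (suc n)) (shift f) ∎
    where
    term : ℕ → ℤ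
    term k = shift f k * (b ^ (suc (suc n) ℕ.∸ 2 ℕ.* k) * c ^ k)
    move : ∀ c x p q → c * (x * (p * q)) ≡ x * (p * (c * q))
    move = solve-∀
    raise : ∀ k → c * (f k * (b ^ (n ℕ.∸ 2 ℕ.* k) * c ^ k)) ≡ term (suc k)
    raise k rewrite ℕP.+-suc k (k ℕ.+ 0) = move c (f k) (b ^ (n ℕ.∸ 2 ℕ.* k)) (c ^ k)
    -- the extra top term f(n+1)·b⁰cⁿ⁺² is zero
    top : ∀ k → suc n ℕ.< k → term k ≡ 0ℤ
    top (suc k) (ℕ.s≤s n<k) = cong (_* _) (vanish k (n<k⇒n<2k n<k))

  d-step : ∀ n (f : ℕ → ℤ) → VanishesAbove n f → d * D.Σw n f ≡ D.Σw (suc n) f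
  d-step n f vanish = begin
      d * D.Σw n f
    ≡⟨ sumTo-scale n d _ ⟩
      sumTo n (λ k → d * (f k * (c ^ k * d ^ (n ℕ.∸ k))))
    ≡⟨ sumTo-cong n raise ⟩
      sumTo n (λ k → f k * (c ^ k * d ^ (suc n ℕ.∸ k)))
    ≡⟨ sym (sumTo-pad n 1 _ (λ k n<k → cong (_* _) (vanish k n<k))) ⟩
      D.Σw (suc n) f ∎
    where
    move : ∀ d x p q → d * (x * (p * q)) ≡ x * (p * (d * q))
    move = solve-∀
    raise : ∀ k → k ℕ.≤ n → d * (f k * (c ^ k * d ^ (n ℕ.∸ k))) ≡ f k * (c ^ k * d ^ (suc n ℕ.∸ k))
    raise k k≤n rewrite ℕP.+-∸-assoc 1 k≤n = move d (f k) (c ^ k) (d ^ (n ℕ.∸ k))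

  c-step-D : ∀ n (f : ℕ → ℤ) → c * D.Σw n f ≡ D.Σw (suc n) (shift f)
  c-step-D n f = begin
      c * D.Σw n f
    ≡⟨ sumTo-scale n c _ ⟩
      sumTo n (λ k → c * (f k * (c ^ k * d ^ (n ℕ.∸ k))))
    ≡⟨ sumTo-cong n (λ k _ → move c (f k) (c ^ k) (d ^ (n ℕ.∸ k))) ⟩
      sumTo n (λ k → f k * (c ^ suc k * d ^ (n ℕ.∸ k)))
    ≡⟨ sym (trans (sumTo-unshift n _) (ℤP.+-identityˡ _)) ⟩
      D.Σw (suc n) (shift f) ∎
    where
    move : ∀ c x p q → c * (x * (p * q)) ≡ x * (c * p * q)
    move = solve-∀

falling : ℤ → ℕ → ℤ
falling x zero    = + 1
falling x (suc m) = x * falling (x - + 1) m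

falling-suc : ∀ x m → falling x (suc m) ≡ falling x m * (x - + m)
falling-suc x zero    = base x
  where
  base : ∀ x → x * + 1 ≡ + 1 * (x - + 0)
  base = solve-∀
falling-suc x (suc m) = begin
    x * falling (x - + 1) (suc m)
  ≡⟨ cong (x *_) (falling-suc (x - + 1) m) ⟩
    x * (falling (x - + 1) m * (x - + 1 - + m))
  ≡⟨ reassoc x _ (+ m) ⟩
    x * falling (x - + 1) m * (x - (+ 1 + + m))
  ≡⟨ cong (λ i → x * falling (x - + 1) m * (x - i)) (sym (ℤP.pos-+ 1 m)) ⟩
    falling x (suc m) * (x - + suc m) ∎
  where
  reassoc : ∀ x y m → x * (y * (x - + 1 - m)) ≡ x * y * (x - (+ 1 + m))
  reassoc = solve-∀

C*!≡falling : ∀ N j → + (N C j) * + (j !) ≡ falling (+ N) j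
C*!≡falling N       zero    = refl
C*!≡falling zero    (suc j) = refl
C*!≡falling (suc N) (suc j) = begin
    + (suc N C suc j) * + (suc j !)
  ≡⟨ cong (λ m → + m * + (suc j !)) (sym (nCk+nC[k+1]≡[n+1]C[k+1] N j)) ⟩
    + (N C j ℕ.+ N C suc j) * + (suc j ℕ.* j !)
  ≡⟨ cong₂ _*_ (ℤP.pos-+ (N C j) (N C suc j)) (ℤP.pos-* (suc j) (j !)) ⟩
    (+ (N C j) + + (N C suc j)) * (+ suc j * + (j !))
  ≡⟨ split (+ (N C j)) (+ (N C suc j)) (+ suc j) (+ (j !)) ⟩
    + suc j * (+ (N C j) * + (j !)) + + (N C suc j) * (+ suc j * + (j !))
  ≡⟨ cong₂ (λ u v → + suc j * u + + (N C suc j) * v) (C*!≡falling N j) (sym (ℤP.pos-* (suc j) (j !))) ⟩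
    + suc j * falling (+ N) j + + (N C suc j) * + (suc j !)
  ≡⟨ cong (λ v → + suc j * falling (+ N) j + v) (trans (C*!≡falling N (suc j)) (falling-suc (+ N) j)) ⟩
    + suc j * falling (+ N) j + falling (+ N) j * (+ N - + j)
  ≡⟨ cong (λ i → i * falling (+ N) j + falling (+ N) j * (+ N - + j)) (ℤP.pos-+ 1 j) ⟩
    (+ 1 + + j) * falling (+ N) j + falling (+ N) j * (+ N - + j)
  ≡⟨ collect (+ j) (falling (+ N) j) (+ N) ⟩
    (+ 1 + + N) * falling (+ N) j
  ≡⟨ cong (_* falling (+ N) j) (sym (ℤP.pos-+ 1 N)) ⟩
    falling (+ suc N) (suc j) ∎
  where
  split : ∀ A B s f → (A + B) * (s * f) ≡ s * (A * f) + B * (s * f)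
  split = solve-∀
  collect : ∀ J F N → (+ 1 + J) * F + F * (N - J) ≡ (+ 1 + N) * F
  collect = solve-∀

falling*!≡! : ∀ j m → falling (+ (j ℕ.+ m)) j * + (m !) ≡ + ((j ℕ.+ m) !)
falling*!≡! zero    m = ℤP.*-identityˡ _
falling*!≡! (suc j) m = begin
    + suc (j ℕ.+ m) * falling (+ (j ℕ.+ m)) j * + (m !)
  ≡⟨ ℤP.*-assoc (+ suc (j ℕ.+ m)) (falling (+ (j ℕ.+ m)) j) (+ (m !)) ⟩
    + suc (j ℕ.+ m) * (falling (+ (j ℕ.+ m)) j * + (m !))
  ≡⟨ cong (+ suc (j ℕ.+ m) *_) (falling*!≡! j m) ⟩
    + suc (j ℕ.+ m) * + ((j ℕ.+ m) !)
  ≡⟨ sym (ℤP.pos-* (suc (j ℕ.+ m)) ((j ℕ.+ m) !)) ⟩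
    + (suc (j ℕ.+ m) !) ∎

2k≡k+k : ∀ k → 2 ℕ.* k ≡ k ℕ.+ k
2k≡k+k k = cong (k ℕ.+_) (ℕP.+-identityʳ k)

central : ∀ k → + ((2 ℕ.* k) C k) * + (k !) * + (k !) ≡ + ((2 ℕ.* k) !)
central k rewrite 2k≡k+k k = trans (cong (_* + (k !)) (C*!≡falling (k ℕ.+ k) k)) (falling*!≡! k k)

t : ℕ → ℕ → ℤ
t n k = (+ (n C (2 ℕ.* k))) * (+ ((2 ℕ.* k) C k))

s : ℕ → ℕ → ℤ
s n k = (+ ((n ℕ.+ k) C (2 ℕ.* k))) * ((+ ((2 ℕ.* k) C k)) ^ 2)

g : ℕ → ℕ → ℤ
g n k = (+ n + + k + + 1) * s n k

t-cleared : ∀ n k → t n k * (+ (k !) * + (k !)) ≡ falling (+ n) (2 ℕ.* k)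
t-cleared n k = begin
    + (n C (2 ℕ.* k)) * + ((2 ℕ.* k) C k) * (+ (k !) * + (k !))
  ≡⟨ reassoc (+ (n C (2 ℕ.* k))) (+ ((2 ℕ.* k) C k)) (+ (k !)) ⟩
    + (n C (2 ℕ.* k)) * (+ ((2 ℕ.* k) C k) * + (k !) * + (k !))
  ≡⟨ cong (+ (n C (2 ℕ.* k)) *_) (central k) ⟩
    + (n C (2 ℕ.* k)) * + ((2 ℕ.* k) !)
  ≡⟨ C*!≡falling n (2 ℕ.* k) ⟩
    falling (+ n) (2 ℕ.* k) ∎
  where
  reassoc : ∀ a c f → a * c * (f * f) ≡ a * (c * f * f)
  reassoc = solve-∀

s-cleared : ∀ n k → s n k * (+ (k !) * + (k !) * (+ (k !) * + (k !)))
                  ≡ falling (+ (n ℕ.+ k)) (2 ℕ.* k) * + ((2 ℕ.* k) !)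
s-cleared n k = begin
    s n k * (+ (k !) * + (k !) * (+ (k !) * + (k !)))
  ≡⟨ reassoc A B (+ (k !)) ⟩
    A * ((B * + (k !) * + (k !)) * (B * + (k !) * + (k !)))
  ≡⟨ cong (λ v → A * (v * v)) (central k) ⟩
    A * (F * F)
  ≡⟨ sym (ℤP.*-assoc A F F) ⟩
    A * F * F
  ≡⟨ cong (_* F) (C*!≡falling (n ℕ.+ k) (2 ℕ.* k)) ⟩
    falling (+ (n ℕ.+ k)) (2 ℕ.* k) * F ∎
  where
  A = + ((n ℕ.+ k) C (2 ℕ.* k))
  B = + ((2 ℕ.* k) C k)
  F = + ((2 ℕ.* k) !)
  reassoc : ∀ a c f → a * (c * (c * + 1)) * (f * f * (f * f)) ≡ a * ((c * f * f) * (c * f * f))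
  reassoc = solve-∀

t-vanishes : ∀ n → VanishesAboveHalf n (t n)
t-vanishes n k n<2k rewrite k>n⇒nCk≡0 n<2k = refl

s-vanishes : ∀ n → VanishesAbove n (s n)
s-vanishes n k n<k rewrite k>n⇒nCk≡0 (subst (n ℕ.+ k ℕ.<_) (sym (2k≡k+k k)) (ℕP.+-monoˡ-< k n<k)) = refl

g-vanishes : ∀ n → VanishesAbove n (g n)
g-vanishes n k n<k = trans (cong ((+ n + + k + + 1) *_) (s-vanishes n k n<k)) (ℤP.*-zeroʳ (+ n + + k + + 1))

-- Each recurrence is checked at k = j+1 after multiplying it by (j+1)!² (for t) or
-- (j+1)!⁴ (for s and g): all coefficients then become falling factorials sharing a
-- common factor, and what remains is a polynomial identity.  The polynomial identities
-- are stated in variables N = n, J = j, …; the accompanying equations such as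
-- N₁ ≡ 1 + N identify the casts + suc n with the polynomials they stand for.

-- `Scaled f x X`: multiplying x by f gives X.  A linear relation between the x's
-- follows from the same relation between the X's when f ≠ 0.
record Scaled (f x X : ℤ) : Set where
  constructor scaled
  field scaled-eq : x * f ≡ X

scaled-* : ∀ α {f x X} → Scaled f x X → Scaled f (α * x) (α * X)
scaled-* α {f} {x} (scaled x·f≡X) = scaled (trans (ℤP.*-assoc α x f) (cong (α *_) x·f≡X))

scaled-+ : ∀ {f x y X Y} → Scaled f x X → Scaled f y Y → Scaled f (x + y) (X + Y)
scaled-+ {f} {x} {y} (scaled x·f≡X) (scaled y·f≡Y) =
  scaled (trans (ℤP.*-distribʳ-+ f x y) (cong₂ _+_ x·f≡X y·f≡Y))

cleared : ∀ {x y X Y} f .{{_ : NonZero f}} → Scaled f x X → Scaled f y Y → X ≡ Y → x ≡ y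
cleared {x} {y} f (scaled x·f≡X) (scaled y·f≡Y) X≡Y =
  ℤP.*-cancelʳ-≡ x y f (trans x·f≡X (trans X≡Y (sym y·f≡Y)))

nonZero-!² : ∀ m → NonZero (+ (m !) * + (m !))
nonZero-!² m = ℤP.i*j≢0 (+ (m !)) (+ (m !)) {{ℕP._!≢0 m}} {{ℕP._!≢0 m}}

nonZero-!⁴ : ∀ m → NonZero (+ (m !) * + (m !) * (+ (m !) * + (m !)))
nonZero-!⁴ m = ℤP.i*j≢0 (+ (m !) * + (m !)) (+ (m !) * + (m !)) {{nonZero-!² m}} {{nonZero-!² m}}

+suc : ∀ m → + suc m ≡ + 1 + + m
+suc = ℤP.pos-+ 1

+[1+m+n] : ∀ m n → + suc (m ℕ.+ n) ≡ + 1 + (+ m + + n)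
+[1+m+n] m n = trans (+suc (m ℕ.+ n)) (cong (_+_ (+ 1)) (ℤP.pos-+ m n))

+[1+2j] : ∀ j → + suc (2 ℕ.* j) ≡ + 1 + + 2 * + j
+[1+2j] j = trans (+suc (2 ℕ.* j)) (cong (_+_ (+ 1)) (ℤP.pos-* 2 j))

t-rec : ∀ n k → (+ n + + 2) * t (suc (suc n)) k
  ≡ (+ 2 * + n + + 3) * t (suc n) k + (- (+ n + + 1)) * t n k + (+ 4 * (+ n + + 1)) * shift (t n) k
t-rec n zero = at-zero (+ n)
  where
  at-zero : ∀ N → (N + + 2) * + 1 ≡ (+ 2 * N + + 3) * + 1 + (- (N + + 1)) * + 1 + (+ 4 * (N + + 1)) * 0ℤ
  at-zero = solve-∀
t-rec n (suc j) =
  cleared f {{nonZero-!² (suc j)}}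
    (scaled-* (+ n + + 2) t[n+2])
    (scaled-+ (scaled-+ (scaled-* (+ 2 * + n + + 3) t[n+1]) (scaled-* (- (+ n + + 1)) t[n]))
              (scaled-* (+ 4 * (+ n + + 1)) t[n,j]))
    (identity (+ n) (+ j) V (+suc n) (ℤP.pos-+ 2 n) (ℤP.pos-* 2 j) (+suc (2 ℕ.* j)) (+suc j))
  where
  f = + (suc j !) * + (suc j !)
  V = falling (+ n) (2 ℕ.* j)
  t[n+2] : Scaled f (t (suc (suc n)) (suc j)) (+ suc (suc n) * (+ suc n * V))
  t[n+2] = scaled (trans (t-cleared (suc (suc n)) (suc j)) (cong (falling (+ suc (suc n))) (2*suc j)))
  t[n+1] : Scaled f (t (suc n) (suc j)) (+ suc n * (V * (+ n - + (2 ℕ.* j))))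
  t[n+1] = scaled (trans (t-cleared (suc n) (suc j))
    (trans (cong (falling (+ suc n)) (2*suc j)) (cong (+ suc n *_) (falling-suc (+ n) (2 ℕ.* j)))))
  t[n] : Scaled f (t n (suc j)) (V * (+ n - + (2 ℕ.* j)) * (+ n - + suc (2 ℕ.* j)))
  t[n] = scaled (trans (t-cleared n (suc j)) (trans (cong (falling (+ n)) (2*suc j))
    (trans (falling-suc (+ n) (suc (2 ℕ.* j))) (cong (_* (+ n - + suc (2 ℕ.* j))) (falling-suc (+ n) (2 ℕ.* j))))))
  t[n,j] : Scaled f (t n j) (+ suc j * + suc j * V)
  t[n,j] = scaled (trans (cong (λ v → t n j * (v * v)) (ℤP.pos-* (suc j) (j !)))
    (trans (reassoc (t n j) (+ suc j) (+ (j !))) (cong (+ suc j * + suc j *_) (t-cleared n j))))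
    where
    reassoc : ∀ x a b → x * (a * b * (a * b)) ≡ a * a * (x * (b * b))
    reassoc = solve-∀
  polynomial : ∀ N J V → (N + + 2) * ((+ 2 + N) * ((+ 1 + N) * V))
    ≡ (+ 2 * N + + 3) * ((+ 1 + N) * (V * (N - + 2 * J)))
      + (- (N + + 1)) * (V * (N - + 2 * J) * (N - (+ 1 + + 2 * J)))
      + (+ 4 * (N + + 1)) * ((+ 1 + J) * (+ 1 + J) * V)
  polynomial = solve-∀
  identity : ∀ N J V {N₁ N₂ M M₁ J₁} →
    N₁ ≡ + 1 + N → N₂ ≡ + 2 + N → M ≡ + 2 * J → M₁ ≡ + 1 + M → J₁ ≡ + 1 + J →
    (N + + 2) * (N₂ * (N₁ * V))
      ≡ (+ 2 * N + + 3) * (N₁ * (V * (N - M))) + (- (N + + 1)) * (V * (N - M) * (N - M₁))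
        + (+ 4 * (N + + 1)) * (J₁ * J₁ * V)
  identity N J V refl refl refl refl refl = polynomial N J V

g-rec : ∀ n k → g (suc n) k ≡ (+ 2 * + n + + 3) * s (suc n) k + (- + 1) * g n k
g-rec n zero = identity (+ n) (+suc n)
  where
  identity : ∀ N {N₁} → N₁ ≡ + 1 + N →
    (N₁ + + 0 + + 1) * + 1 ≡ (+ 2 * N + + 3) * + 1 + (- + 1) * ((N + + 0 + + 1) * + 1)
  identity N refl = polynomial N
    where
    polynomial : ∀ N → (+ 1 + N + + 0 + + 1) * + 1 ≡ (+ 2 * N + + 3) * + 1 + (- + 1) * ((N + + 0 + + 1) * + 1)
    polynomial = solve-∀
g-rec n (suc j) =
  cleared f {{nonZero-!⁴ (suc j)}}
    (scaled-* (+ suc n + + suc j + + 1) s[n+1])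
    (scaled-+ (scaled-* (+ 2 * + n + + 3) s[n+1]) (scaled-* (- + 1) (scaled-* (+ n + + suc j + + 1) s[n])))
    (identity (+ n) (+ j) V F (+suc n) (+suc j) (+[1+m+n] n j) (+suc (suc X)) (+[1+2j] j))
  where
  f = + (suc j !) * + (suc j !) * (+ (suc j !) * + (suc j !))
  X = n ℕ.+ j
  V = falling (+ suc X) (suc (2 ℕ.* j))
  F = + ((2 ℕ.* suc j) !)
  s[n+1] : Scaled f (s (suc n) (suc j)) (+ suc (suc X) * V * F)
  s[n+1] = scaled (trans (s-cleared (suc n) (suc j))
    (cong₂ (λ x m → falling (+ suc x) m * F) (ℕP.+-suc n j) (2*suc j)))
  s[n] : Scaled f (s n (suc j)) (V * (+ suc X - + suc (2 ℕ.* j)) * F)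
  s[n] = scaled (trans (s-cleared n (suc j)) (trans (cong₂ (λ x m → falling (+ x) m * F) (ℕP.+-suc n j) (2*suc j))
    (cong (_* F) (falling-suc (+ suc X) (suc (2 ℕ.* j))))))
  polynomial : ∀ N J V F →
    (+ 1 + N + (+ 1 + J) + + 1) * ((+ 1 + (+ 1 + (N + J))) * V * F)
      ≡ (+ 2 * N + + 3) * ((+ 1 + (+ 1 + (N + J))) * V * F)
        + (- + 1) * ((N + (+ 1 + J) + + 1) * (V * ((+ 1 + (N + J)) - (+ 1 + + 2 * J)) * F))
  polynomial = solve-∀
  identity : ∀ N J V F {N₁ J₁ X₁ X₂ R} →
    N₁ ≡ + 1 + N → J₁ ≡ + 1 + J → X₁ ≡ + 1 + (N + J) → X₂ ≡ + 1 + X₁ → R ≡ + 1 + + 2 * J →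
    (N₁ + J₁ + + 1) * (X₂ * V * F)
      ≡ (+ 2 * N + + 3) * (X₂ * V * F) + (- + 1) * ((N + J₁ + + 1) * (V * (X₁ - R) * F))
  identity N J V F refl refl refl refl refl = polynomial N J V F

s-rec : ∀ n k → (+ n + + 2) * (+ n + + 2) * s (suc (suc n)) k
  ≡ (+ 2 * + n + + 3) * (+ 2 * + n + + 3) * s (suc n) k
    + (+ 4 * ((+ 2 * + n + + 3) * (+ 2 * + n + + 3))) * shift (s (suc n)) k
    + (- (+ 2 * (+ 2 * + n + + 3))) * g n k
    + (- (+ 8 * (+ 2 * + n + + 3))) * shift (g n) k
    + (+ n + + 1) * (+ n + + 1) * s n k
s-rec n zero = at-zero (+ n)
  where
  at-zero : ∀ N → (N + + 2) * (N + + 2) * + 1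
    ≡ (+ 2 * N + + 3) * (+ 2 * N + + 3) * + 1 + (+ 4 * ((+ 2 * N + + 3) * (+ 2 * N + + 3))) * 0ℤ
      + (- (+ 2 * (+ 2 * N + + 3))) * ((N + + 0 + + 1) * + 1) + (- (+ 8 * (+ 2 * N + + 3))) * 0ℤ
      + (N + + 1) * (N + + 1) * + 1
  at-zero = solve-∀
-- k = 1 separately: with k = j+1 and j = 0, the terms s(n+1,0), g(n,0) share no falling
-- factor with the others; for k = j+2 the common factor is (n+j+1)⋯(n−j+1).
s-rec n (suc zero) =
  cleared (+ 1) (scaled-* ((+ n + + 2) * (+ n + + 2)) s[n+2])
    (scaled-+ (scaled-+ (scaled-+ (scaled-+
      (scaled-* ((+ 2 * + n + + 3) * (+ 2 * + n + + 3)) s[n+1])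
      (scaled-* (+ 4 * ((+ 2 * + n + + 3) * (+ 2 * + n + + 3))) s[n+1,0]))
      (scaled-* (- (+ 2 * (+ 2 * + n + + 3))) (scaled-* (+ n + + 1 + + 1) s[n])))
      (scaled-* (- (+ 8 * (+ 2 * + n + + 3))) (scaled (ℤP.*-identityʳ (g n 0)))))
      (scaled-* ((+ n + + 1) * (+ n + + 1)) s[n]))
    (identity (+ n) (+suc n) (+suc (suc n)) (+suc (suc (suc n))))
  where
  s[n+2] : Scaled (+ 1) (s (suc (suc n)) 1) (+ suc (suc (suc n)) * (+ suc (suc n) * + 1) * + 2)
  s[n+2] = scaled (trans (s-cleared (suc (suc n)) 1)
    (cong (λ x → falling (+ x) 2 * + 2) (cong (λ x → suc (suc x)) (ℕP.+-comm n 1))))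
  s[n+1] : Scaled (+ 1) (s (suc n) 1) (+ suc (suc n) * (+ suc n * + 1) * + 2)
  s[n+1] = scaled (trans (s-cleared (suc n) 1) (cong (λ x → falling (+ x) 2 * + 2) (cong suc (ℕP.+-comm n 1))))
  s[n+1,0] : Scaled (+ 1) (s (suc n) 0) (+ 1)
  s[n+1,0] = scaled refl
  s[n] : Scaled (+ 1) (s n 1) (+ suc n * (+ n * + 1) * + 2)
  s[n] = scaled (trans (s-cleared n 1) (cong (λ x → falling (+ x) 2 * + 2) (ℕP.+-comm n 1)))
  polynomial : ∀ N → (N + + 2) * (N + + 2) * ((+ 1 + (+ 1 + (+ 1 + N))) * ((+ 1 + (+ 1 + N)) * + 1) * + 2)
    ≡ (+ 2 * N + + 3) * (+ 2 * N + + 3) * ((+ 1 + (+ 1 + N)) * ((+ 1 + N) * + 1) * + 2)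
      + (+ 4 * ((+ 2 * N + + 3) * (+ 2 * N + + 3))) * + 1
      + (- (+ 2 * (+ 2 * N + + 3))) * ((N + + 1 + + 1) * ((+ 1 + N) * (N * + 1) * + 2))
      + (- (+ 8 * (+ 2 * N + + 3))) * ((N + + 0 + + 1) * + 1)
      + (N + + 1) * (N + + 1) * ((+ 1 + N) * (N * + 1) * + 2)
  polynomial = solve-∀
  identity : ∀ N {N₁ N₂ N₃} → N₁ ≡ + 1 + N → N₂ ≡ + 1 + N₁ → N₃ ≡ + 1 + N₂ →
    (N + + 2) * (N + + 2) * (N₃ * (N₂ * + 1) * + 2)
      ≡ (+ 2 * N + + 3) * (+ 2 * N + + 3) * (N₂ * (N₁ * + 1) * + 2)
        + (+ 4 * ((+ 2 * N + + 3) * (+ 2 * N + + 3))) * + 1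
        + (- (+ 2 * (+ 2 * N + + 3))) * ((N + + 1 + + 1) * (N₁ * (N * + 1) * + 2))
        + (- (+ 8 * (+ 2 * N + + 3))) * ((N + + 0 + + 1) * + 1)
        + (N + + 1) * (N + + 1) * (N₁ * (N * + 1) * + 2)
  identity N refl refl refl = polynomial N
s-rec n (suc (suc j)) =
  cleared f {{nonZero-!⁴ (suc (suc j))}} (scaled-* ((+ n + + 2) * (+ n + + 2)) s[n+2])
    (scaled-+ (scaled-+ (scaled-+ (scaled-+
      (scaled-* ((+ 2 * + n + + 3) * (+ 2 * + n + + 3)) s[n+1])
      (scaled-* (+ 4 * ((+ 2 * + n + + 3) * (+ 2 * + n + + 3))) s[n+1,j+1]))
      (scaled-* (- (+ 2 * (+ 2 * + n + + 3))) (scaled-* (+ n + + suc (suc j) + + 1) s[n])))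
      (scaled-* (- (+ 8 * (+ 2 * + n + + 3))) (scaled-* (+ n + + suc j + + 1) s[n,j+1])))
      (scaled-* ((+ n + + 1) * (+ n + + 1)) s[n]))
    (identity (+ n) (+ j) V F′ (+[1+m+n] n j) (+suc (suc X)) (+suc (suc (suc X))) (+suc (suc (suc (suc X))))
      (+[1+2j] j) (+suc (suc m)) (+suc (suc (suc m))) (+suc (suc (suc (suc m)))) (+suc j) (+suc (suc j)) F≡)
  where
  m = 2 ℕ.* j
  X = n ℕ.+ j
  J₂ = + suc (suc j)
  f = + (suc (suc j) !) * + (suc (suc j) !) * (+ (suc (suc j) !) * + (suc (suc j) !))
  f′ = + (suc j !) * + (suc j !) * (+ (suc j !) * + (suc j !))
  V = falling (+ suc X) (suc m)
  F = + ((2 ℕ.* suc (suc j)) !)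
  F′ = + ((2 ℕ.* suc j) !)
  n+[j+2] : n ℕ.+ suc (suc j) ≡ suc (suc X)
  n+[j+2] = trans (ℕP.+-suc n (suc j)) (cong suc (ℕP.+-suc n j))
  2[j+2] : 2 ℕ.* suc (suc j) ≡ suc (suc (suc (suc m)))
  2[j+2] = trans (2*suc (suc j)) (cong (λ x → suc (suc x)) (2*suc j))
  -- (j+2)!⁴ = (j+2)⁴ (j+1)!⁴ relates the two factorial scales.
  rescale : ∀ x → x * f ≡ J₂ * J₂ * (J₂ * J₂) * (x * f′)
  rescale x = trans (cong (λ v → x * (v * v * (v * v))) (ℤP.pos-* (suc (suc j)) (suc j !))) (reassoc x J₂ (+ (suc j !)))
    where
    reassoc : ∀ x a b → x * (a * b * (a * b) * (a * b * (a * b))) ≡ a * a * (a * a) * (x * (b * b * (b * b)))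
    reassoc = solve-∀
  s[n+2] : Scaled f (s (suc (suc n)) (suc (suc j))) (+ suc (suc (suc (suc X))) * (+ suc (suc (suc X)) * (+ suc (suc X) * V)) * F)
  s[n+2] = scaled (trans (s-cleared (suc (suc n)) (suc (suc j)))
    (cong₂ (λ x m → falling (+ suc (suc x)) m * F) n+[j+2] 2[j+2]))
  s[n+1] : Scaled f (s (suc n) (suc (suc j))) (+ suc (suc (suc X)) * (+ suc (suc X) * (V * (+ suc X - + suc m))) * F)
  s[n+1] = scaled (trans (s-cleared (suc n) (suc (suc j))) (trans (cong₂ (λ x m → falling (+ suc x) m * F) n+[j+2] 2[j+2])
    (cong (λ v → + suc (suc (suc X)) * (+ suc (suc X) * v) * F) (falling-suc (+ suc X) (suc m)))))
  s[n+1,j+1] : Scaled f (s (suc n) (suc j)) (J₂ * J₂ * (J₂ * J₂) * (+ suc (suc X) * V * F′))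
  s[n+1,j+1] = scaled (trans (rescale (s (suc n) (suc j))) (cong (J₂ * J₂ * (J₂ * J₂) *_)
    (trans (s-cleared (suc n) (suc j)) (cong₂ (λ x m → falling (+ suc x) m * F′) (ℕP.+-suc n j) (2*suc j)))))
  s[n] : Scaled f (s n (suc (suc j))) (+ suc (suc X) * (V * (+ suc X - + suc m) * (+ suc X - + suc (suc m))) * F)
  s[n] = scaled (trans (s-cleared n (suc (suc j))) (trans (cong₂ (λ x m → falling (+ x) m * F) n+[j+2] 2[j+2])
    (cong (λ v → + suc (suc X) * v * F)
      (trans (falling-suc (+ suc X) (suc (suc m))) (cong (_* (+ suc X - + suc (suc m))) (falling-suc (+ suc X) (suc m)))))))
  s[n,j+1] : Scaled f (s n (suc j)) (J₂ * J₂ * (J₂ * J₂) * (V * (+ suc X - + suc m) * F′))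
  s[n,j+1] = scaled (trans (rescale (s n (suc j))) (cong (J₂ * J₂ * (J₂ * J₂) *_)
    (trans (s-cleared n (suc j)) (trans (cong₂ (λ x m → falling (+ x) m * F′) (ℕP.+-suc n j) (2*suc j))
      (cong (_* F′) (falling-suc (+ suc X) (suc m)))))))
  F≡ : F ≡ + suc (suc (suc (suc m))) * (+ suc (suc (suc m)) * F′)
  F≡ = trans (cong (λ x → + (x !)) 2[j+2])
    (trans (ℤP.pos-* (suc (suc (suc (suc m)))) (suc (suc (suc m)) !))
      (trans (cong (+ suc (suc (suc (suc m))) *_) (ℤP.pos-* (suc (suc (suc m))) (suc (suc m) !)))
        (cong (λ x → + suc (suc (suc (suc m))) * (+ suc (suc (suc m)) * + (x !))) (sym (2*suc j)))))
  polynomial : ∀ N J V F′ →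
    let X₁ = + 1 + (N + J) ; X₂ = + 1 + X₁ ; X₃ = + 1 + X₂ ; X₄ = + 1 + X₃
        R₁ = + 1 + + 2 * J ; R₂ = + 1 + R₁ ; R₃ = + 1 + R₂ ; R₄ = + 1 + R₃
        J₁ = + 1 + J ; J₂ = + 1 + J₁ ; F = R₄ * (R₃ * F′) in
    (N + + 2) * (N + + 2) * (X₄ * (X₃ * (X₂ * V)) * F)
      ≡ (+ 2 * N + + 3) * (+ 2 * N + + 3) * (X₃ * (X₂ * (V * (X₁ - R₁))) * F)
        + (+ 4 * ((+ 2 * N + + 3) * (+ 2 * N + + 3))) * (J₂ * J₂ * (J₂ * J₂) * (X₂ * V * F′))
        + (- (+ 2 * (+ 2 * N + + 3))) * ((N + J₂ + + 1) * (X₂ * (V * (X₁ - R₁) * (X₁ - R₂)) * F))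
        + (- (+ 8 * (+ 2 * N + + 3))) * ((N + J₁ + + 1) * (J₂ * J₂ * (J₂ * J₂) * (V * (X₁ - R₁) * F′)))
        + (N + + 1) * (N + + 1) * (X₂ * (V * (X₁ - R₁) * (X₁ - R₂)) * F)
  polynomial = solve-∀
  identity : ∀ N J V F′ {X₁ X₂ X₃ X₄ R₁ R₂ R₃ R₄ J₁ J₂ F} →
    X₁ ≡ + 1 + (N + J) → X₂ ≡ + 1 + X₁ → X₃ ≡ + 1 + X₂ → X₄ ≡ + 1 + X₃ →
    R₁ ≡ + 1 + + 2 * J → R₂ ≡ + 1 + R₁ → R₃ ≡ + 1 + R₂ → R₄ ≡ + 1 + R₃ →
    J₁ ≡ + 1 + J → J₂ ≡ + 1 + J₁ → F ≡ R₄ * (R₃ * F′) →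
    (N + + 2) * (N + + 2) * (X₄ * (X₃ * (X₂ * V)) * F)
      ≡ (+ 2 * N + + 3) * (+ 2 * N + + 3) * (X₃ * (X₂ * (V * (X₁ - R₁))) * F)
        + (+ 4 * ((+ 2 * N + + 3) * (+ 2 * N + + 3))) * (J₂ * J₂ * (J₂ * J₂) * (X₂ * V * F′))
        + (- (+ 2 * (+ 2 * N + + 3))) * ((N + J₂ + + 1) * (X₂ * (V * (X₁ - R₁) * (X₁ - R₂)) * F))
        + (- (+ 8 * (+ 2 * N + + 3))) * ((N + J₁ + + 1) * (J₂ * J₂ * (J₂ * J₂) * (V * (X₁ - R₁) * F′)))
        + (N + + 1) * (N + + 1) * (X₂ * (V * (X₁ - R₁) * (X₁ - R₂)) * F)
  identity N J V F′ refl refl refl refl refl refl refl refl refl refl refl = polynomial N J V F′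

-- With x, y, z standing for T_n, T_{n+1}, T_{n+2}, the recurrence (R) for z together
-- with the invariant at n gives the invariant at n+1.  Only (R), (Q₁), (Q₂) are used,
-- so b and d are arbitrary here.

-- (n+2)² T_{n+2}² = (n+2)² S_{n+2}: square (R) and substitute the invariant into (Q₂).
square-step : ∀ N b d x y z S₀ S₁ S₂ G₀ →
  (N + + 2) * z ≡ (+ 2 * N + + 3) * b * y - (N + + 1) * d * x →
  x * x ≡ S₀ → y * y ≡ S₁ → (N + + 1) * (x * y) ≡ b * G₀ →
  (N + + 2) * (N + + 2) * S₂ ≡ (+ 2 * N + + 3) * (+ 2 * N + + 3) * (b * b) * S₁
                              - + 2 * (+ 2 * N + + 3) * (b * b) * (d * G₀) + (N + + 1) * (N + + 1) * (d * d) * S₀ →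
  (N + + 2) * (N + + 2) * (z * z) ≡ (N + + 2) * (N + + 2) * S₂
square-step N b d x y z S₀ S₁ S₂ G₀ rec x²≡S₀ y²≡S₁ xy≡bG₀ S-rec₂ = begin
    (N + + 2) * (N + + 2) * (z * z)
  ≡⟨ square-out N z ⟩
    (N + + 2) * z * ((N + + 2) * z)
  ≡⟨ cong₂ _*_ rec rec ⟩
    ((+ 2 * N + + 3) * b * y - (N + + 1) * d * x) * ((+ 2 * N + + 3) * b * y - (N + + 1) * d * x)
  ≡⟨ expand N b d x y ⟩
    (+ 2 * N + + 3) * (+ 2 * N + + 3) * (b * b) * (y * y)
      - + 2 * (+ 2 * N + + 3) * b * d * ((N + + 1) * (x * y)) + (N + + 1) * (N + + 1) * (d * d) * (x * x)
  ≡⟨ cong₃ (λ u v w → (+ 2 * N + + 3) * (+ 2 * N + + 3) * (b * b) * u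
                       - + 2 * (+ 2 * N + + 3) * b * d * v + (N + + 1) * (N + + 1) * (d * d) * w)
           y²≡S₁ xy≡bG₀ x²≡S₀ ⟩
    (+ 2 * N + + 3) * (+ 2 * N + + 3) * (b * b) * S₁
      - + 2 * (+ 2 * N + + 3) * b * d * (b * G₀) + (N + + 1) * (N + + 1) * (d * d) * S₀
  ≡⟨ regroup N b d S₀ S₁ G₀ ⟩
    (+ 2 * N + + 3) * (+ 2 * N + + 3) * (b * b) * S₁
      - + 2 * (+ 2 * N + + 3) * (b * b) * (d * G₀) + (N + + 1) * (N + + 1) * (d * d) * S₀
  ≡⟨ sym S-rec₂ ⟩
    (N + + 2) * (N + + 2) * S₂ ∎
  where
  cong₃ : ∀ (h : ℤ → ℤ → ℤ → ℤ) {u u′ v v′ w w′} → u ≡ u′ → v ≡ v′ → w ≡ w′ → h u v w ≡ h u′ v′ w′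
  cong₃ h refl refl refl = refl
  square-out : ∀ N z → (N + + 2) * (N + + 2) * (z * z) ≡ (N + + 2) * z * ((N + + 2) * z)
  square-out = solve-∀
  expand : ∀ N b d x y →
    ((+ 2 * N + + 3) * b * y - (N + + 1) * d * x) * ((+ 2 * N + + 3) * b * y - (N + + 1) * d * x)
      ≡ (+ 2 * N + + 3) * (+ 2 * N + + 3) * (b * b) * (y * y)
        - + 2 * (+ 2 * N + + 3) * b * d * ((N + + 1) * (x * y)) + (N + + 1) * (N + + 1) * (d * d) * (x * x)
  expand = solve-∀
  regroup : ∀ N b d S₀ S₁ G₀ →
    (+ 2 * N + + 3) * (+ 2 * N + + 3) * (b * b) * S₁
      - + 2 * (+ 2 * N + + 3) * b * d * (b * G₀) + (N + + 1) * (N + + 1) * (d * d) * S₀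
      ≡ (+ 2 * N + + 3) * (+ 2 * N + + 3) * (b * b) * S₁
        - + 2 * (+ 2 * N + + 3) * (b * b) * (d * G₀) + (N + + 1) * (N + + 1) * (d * d) * S₀
  regroup = solve-∀

-- (n+2) T_{n+1} T_{n+2} = b G_{n+1}: multiply (R) by y and substitute the invariant into (Q₁).
product-step : ∀ N b d x y z S₁ G₀ G₁ →
  (N + + 2) * z ≡ (+ 2 * N + + 3) * b * y - (N + + 1) * d * x →
  y * y ≡ S₁ → (N + + 1) * (x * y) ≡ b * G₀ →
  G₁ ≡ (+ 2 * N + + 3) * S₁ - d * G₀ →
  (N + + 2) * (y * z) ≡ b * G₁
product-step N b d x y z S₁ G₀ G₁ rec y²≡S₁ xy≡bG₀ G-rec₁ = begin
    (N + + 2) * (y * z)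
  ≡⟨ pull-y N y z ⟩
    y * ((N + + 2) * z)
  ≡⟨ cong (y *_) rec ⟩
    y * ((+ 2 * N + + 3) * b * y - (N + + 1) * d * x)
  ≡⟨ expand N b d x y ⟩
    (+ 2 * N + + 3) * b * (y * y) - d * ((N + + 1) * (x * y))
  ≡⟨ cong₂ (λ u v → (+ 2 * N + + 3) * b * u - d * v) y²≡S₁ xy≡bG₀ ⟩
    (+ 2 * N + + 3) * b * S₁ - d * (b * G₀)
  ≡⟨ factor-b N b d S₁ G₀ ⟩
    b * ((+ 2 * N + + 3) * S₁ - d * G₀)
  ≡⟨ cong (b *_) (sym G-rec₁) ⟩
    b * G₁ ∎
  where
  pull-y : ∀ N y z → (N + + 2) * (y * z) ≡ y * ((N + + 2) * z)
  pull-y = solve-∀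
  expand : ∀ N b d x y → y * ((+ 2 * N + + 3) * b * y - (N + + 1) * d * x)
    ≡ (+ 2 * N + + 3) * b * (y * y) - d * ((N + + 1) * (x * y))
  expand = solve-∀
  factor-b : ∀ N b d S G → (+ 2 * N + + 3) * b * S - d * (b * G) ≡ b * ((+ 2 * N + + 3) * S - d * G)
  factor-b = solve-∀

module Recurrences (b c : ℤ) where
  open Weights b c

  -- T′ n is T_n summed up to n instead of ⌊n/2⌋.
  T′ S G : ℕ → ℤ
  T′ n = B.Σw n (t n)
  S  n = D.Σw n (s n)
  G  n = D.Σw n (g n)

  T≡T′ : ∀ n → T n b c ≡ T′ n
  T≡T′ n = begin
      T n b c
    ≡⟨ sym (sumTo-pad (n ℕ./ 2) (n ℕ.∸ n ℕ./ 2) term beyond-half) ⟩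
      sumTo ((n ℕ.∸ n ℕ./ 2) ℕ.+ n ℕ./ 2) term
    ≡⟨ cong (λ m → sumTo m term) (ℕP.m∸n+n≡m (ℕDM.m/n≤m n 2)) ⟩
      sumTo n term
    ≡⟨ sumTo-cong n (λ k _ → ℤP.*-assoc (t n k) (b ^ (n ℕ.∸ 2 ℕ.* k)) (c ^ k)) ⟩
      T′ n ∎
    where
    term : ℕ → ℤ
    term k = t n k * b ^ (n ℕ.∸ 2 ℕ.* k) * c ^ k
    2k/2≡k : ∀ k → 2 ℕ.* k ℕ./ 2 ≡ k
    2k/2≡k k = trans (cong (ℕ._/ 2) (ℕP.*-comm 2 k)) (ℕDM.m*n/n≡m k 2)
    beyond-half : ∀ k → n ℕ./ 2 ℕ.< k → term k ≡ 0ℤ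
    beyond-half k n/2<k with n ℕ.<? 2 ℕ.* k
    ... | yes n<2k = cong (λ x → x * b ^ (n ℕ.∸ 2 ℕ.* k) * c ^ k) (t-vanishes n k n<2k)
    ... | no n≮2k = contradiction n/2<k
          (ℕP.≤⇒≯ (subst (ℕ._≤ n ℕ./ 2) (2k/2≡k k) (ℕDM./-monoˡ-≤ 2 (ℕP.≮⇒≥ n≮2k))))

  T′-rec : ∀ n → (+ n + + 2) * T′ (suc (suc n)) ≡ (+ 2 * + n + + 3) * b * T′ (suc n) - (+ n + + 1) * d * T′ n
  T′-rec n = begin
      (+ n + + 2) * T′ (suc (suc n))
    ≡⟨ B.Σw-scale (suc (suc n)) (+ n + + 2) (t (suc (suc n))) ⟩
      B.Σw (suc (suc n)) (λ k → (+ n + + 2) * t (suc (suc n)) k)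
    ≡⟨ B.Σw-cong (suc (suc n)) (t-rec n) ⟩
      B.Σw (suc (suc n)) (λ k → α * t (suc n) k + β * t n k + γ * shift (t n) k)
    ≡⟨ sym (B.Σw-lin₃ (suc (suc n)) α (t (suc n)) β (t n) γ (shift (t n))) ⟩
      α * B.Σw (suc (suc n)) (t (suc n)) + β * B.Σw (suc (suc n)) (t n) + γ * B.Σw (suc (suc n)) (shift (t n))
    ≡⟨ sym (cong₂ _+_ (cong₂ _+_ (cong (α *_) b·T′[n+1]) (cong (β *_) b²·T′[n])) (cong (γ *_) c·T′[n])) ⟩
      α * (b * T′ (suc n)) + β * (b * (b * T′ n)) + γ * (c * T′ n)
    ≡⟨ collect (+ n) b c (T′ n) (T′ (suc n)) ⟩
      (+ 2 * + n + + 3) * b * T′ (suc n) - (+ n + + 1) * d * T′ n ∎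
    where
    α = + 2 * + n + + 3
    β = - (+ n + + 1)
    γ = + 4 * (+ n + + 1)
    b·T′[n+1] : b * T′ (suc n) ≡ B.Σw (suc (suc n)) (t (suc n))
    b·T′[n+1] = b-step (suc n) (t (suc n)) (t-vanishes (suc n))
    b²·T′[n] : b * (b * T′ n) ≡ B.Σw (suc (suc n)) (t n)
    b²·T′[n] = trans (cong (b *_) (b-step n (t n) (t-vanishes n)))
                     (b-step (suc n) (t n) (vanishesAboveHalf-suc (t-vanishes n)))
    c·T′[n] : c * T′ n ≡ B.Σw (suc (suc n)) (shift (t n))
    c·T′[n] = c-step-B n (t n) (t-vanishes n)
    collect : ∀ N b c x y →
      (+ 2 * N + + 3) * (b * y) + (- (N + + 1)) * (b * (b * x)) + (+ 4 * (N + + 1)) * (c * x)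
        ≡ (+ 2 * N + + 3) * b * y - (N + + 1) * (b * b - + 4 * c) * x
    collect = solve-∀

  d·G : ∀ n → d * G n ≡ D.Σw (suc n) (g n)
  d·G n = d-step n (g n) (g-vanishes n)

  G-rec : ∀ n → G (suc n) ≡ (+ 2 * + n + + 3) * S (suc n) - d * G n
  G-rec n = begin
      G (suc n)
    ≡⟨ D.Σw-cong (suc n) (g-rec n) ⟩
      D.Σw (suc n) (λ k → (+ 2 * + n + + 3) * s (suc n) k + (- + 1) * g n k)
    ≡⟨ sym (D.Σw-lin₂ (suc n) (+ 2 * + n + + 3) (s (suc n)) (- + 1) (g n)) ⟩
      (+ 2 * + n + + 3) * S (suc n) + (- + 1) * D.Σw (suc n) (g n)
    ≡⟨ cong (λ v → (+ 2 * + n + + 3) * S (suc n) + (- + 1) * v) (sym (d·G n)) ⟩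
      (+ 2 * + n + + 3) * S (suc n) + (- + 1) * (d * G n)
    ≡⟨ cong (_+_ ((+ 2 * + n + + 3) * S (suc n))) (ℤP.-1*i≡-i (d * G n)) ⟩
      (+ 2 * + n + + 3) * S (suc n) - d * G n ∎

  S-rec : ∀ n → (+ n + + 2) * (+ n + + 2) * S (suc (suc n))
    ≡ (+ 2 * + n + + 3) * (+ 2 * + n + + 3) * (b * b) * S (suc n)
      - + 2 * (+ 2 * + n + + 3) * (b * b) * (d * G n) + (+ n + + 1) * (+ n + + 1) * (d * d) * S n
  S-rec n = begin
      (+ n + + 2) * (+ n + + 2) * S (suc (suc n))
    ≡⟨ D.Σw-scale (suc (suc n)) ((+ n + + 2) * (+ n + + 2)) (s (suc (suc n))) ⟩
      D.Σw (suc (suc n)) (λ k → (+ n + + 2) * (+ n + + 2) * s (suc (suc n)) k)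
    ≡⟨ D.Σw-cong (suc (suc n)) (s-rec n) ⟩
      D.Σw (suc (suc n)) (λ k → α₁ * s (suc n) k + α₂ * shift (s (suc n)) k + α₃ * g n k
                                + α₄ * shift (g n) k + α₅ * s n k)
    ≡⟨ sym (D.Σw-lin₅ (suc (suc n)) α₁ (s (suc n)) α₂ (shift (s (suc n))) α₃ (g n) α₄ (shift (g n)) α₅ (s n)) ⟩
      α₁ * D.Σw (suc (suc n)) (s (suc n)) + α₂ * D.Σw (suc (suc n)) (shift (s (suc n)))
        + α₃ * D.Σw (suc (suc n)) (g n) + α₄ * D.Σw (suc (suc n)) (shift (g n)) + α₅ * D.Σw (suc (suc n)) (s n)
    ≡⟨ sym (cong₂ _+_ (cong₂ _+_ (cong₂ _+_ (cong₂ _+_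
              (cong (α₁ *_) d·S[n+1]) (cong (α₂ *_) c·S[n+1])) (cong (α₃ *_) d²·G[n]))
              (cong (α₄ *_) cd·G[n])) (cong (α₅ *_) d²·S[n])) ⟩
      α₁ * (d * S (suc n)) + α₂ * (c * S (suc n)) + α₃ * (d * (d * G n)) + α₄ * (c * (d * G n))
        + α₅ * (d * (d * S n))
    ≡⟨ collect (+ n) b c (S n) (S (suc n)) (G n) ⟩
      (+ 2 * + n + + 3) * (+ 2 * + n + + 3) * (b * b) * S (suc n)
        - + 2 * (+ 2 * + n + + 3) * (b * b) * (d * G n) + (+ n + + 1) * (+ n + + 1) * (d * d) * S n ∎
    where
    α₁ = (+ 2 * + n + + 3) * (+ 2 * + n + + 3)
    α₂ = + 4 * ((+ 2 * + n + + 3) * (+ 2 * + n + + 3))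
    α₃ = - (+ 2 * (+ 2 * + n + + 3))
    α₄ = - (+ 8 * (+ 2 * + n + + 3))
    α₅ = (+ n + + 1) * (+ n + + 1)
    d·S[n+1] : d * S (suc n) ≡ D.Σw (suc (suc n)) (s (suc n))
    d·S[n+1] = d-step (suc n) (s (suc n)) (s-vanishes (suc n))
    c·S[n+1] : c * S (suc n) ≡ D.Σw (suc (suc n)) (shift (s (suc n)))
    c·S[n+1] = c-step-D (suc n) (s (suc n))
    d²·G[n] : d * (d * G n) ≡ D.Σw (suc (suc n)) (g n)
    d²·G[n] = trans (cong (d *_) (d·G n)) (d-step (suc n) (g n) (vanishesAbove-suc (g-vanishes n)))
    cd·G[n] : c * (d * G n) ≡ D.Σw (suc (suc n)) (shift (g n))
    cd·G[n] = trans (cong (c *_) (d·G n)) (c-step-D (suc n) (g n))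
    d²·S[n] : d * (d * S n) ≡ D.Σw (suc (suc n)) (s n)
    d²·S[n] = trans (cong (d *_) (d-step n (s n) (s-vanishes n)))
                    (d-step (suc n) (s n) (vanishesAbove-suc (s-vanishes n)))
    collect : ∀ N b c S₀ S₁ G₀ → let d = b * b - + 4 * c ; A = + 2 * N + + 3 in
      A * A * (d * S₁) + + 4 * (A * A) * (c * S₁) + (- (+ 2 * A)) * (d * (d * G₀))
        + (- (+ 8 * A)) * (c * (d * G₀)) + (N + + 1) * (N + + 1) * (d * (d * S₀))
      ≡ A * A * (b * b) * S₁ - + 2 * A * (b * b) * (d * G₀) + (N + + 1) * (N + + 1) * (d * d) * S₀
    collect = solve-∀

  Invariant : ℕ → Set
  Invariant n = (T′ n * T′ n ≡ S n) × (T′ (suc n) * T′ (suc n) ≡ S (suc n))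
              × ((+ n + + 1) * (T′ n * T′ (suc n)) ≡ b * G n)

  invariant : ∀ n → Invariant n
  invariant zero = refl , base₁ b c , base₂ b
    where
    -- T₁ = b and S₁ = d + 4c, written out as the sums compute.
    base₁ : ∀ b c → (+ 1 * + 1 * (b * + 1 * + 1) + + 0) * (+ 1 * + 1 * (b * + 1 * + 1) + + 0)
      ≡ + 1 * + 1 * (+ 1 * ((b * b - + 4 * c) * + 1)) + + 1 * + 4 * (c * + 1 * + 1)
    base₁ = solve-∀
    -- 1 · T₀ T₁ = b G₀ with T₀ = G₀ = 1.
    base₂ : ∀ b → (+ 0 + + 1) * (+ 1 * + 1 * (+ 1 * + 1) * (+ 1 * + 1 * (b * + 1 * + 1) + + 0))
      ≡ b * ((+ 0 + + 0 + + 1) * + 1 * (+ 1 * + 1))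
    base₂ = solve-∀
  invariant (suc n) with invariant n
  ... | T₀²≡S₀ , T₁²≡S₁ , T₀T₁≡bG₀ = T₁²≡S₁ , T₂²≡S₂ , T₁T₂≡bG₁
    where
    T₂²≡S₂ : T′ (suc (suc n)) * T′ (suc (suc n)) ≡ S (suc (suc n))
    T₂²≡S₂ = ℤP.*-cancelˡ-≡ ((+ n + + 2) * (+ n + + 2)) _ _ {{ℤP.i*j≢0 (+ n + + 2) (+ n + + 2) {{n+2≢0}} {{n+2≢0}}}}
      (square-step (+ n) b d _ _ _ _ _ _ _ (T′-rec n) T₀²≡S₀ T₁²≡S₁ T₀T₁≡bG₀ (S-rec n))
      where
      n+2≢0 : NonZero (+ n + + 2)
      n+2≢0 = ℕ.≢-nonZero (ℕP.m+1+n≢0 n)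
    T₁T₂≡bG₁ : (+ suc n + + 1) * (T′ (suc n) * T′ (suc (suc n))) ≡ b * G (suc n)
    T₁T₂≡bG₁ = trans (cong (λ m → + m * (T′ (suc n) * T′ (suc (suc n)))) (sym (ℕP.+-suc n 1)))
      (product-step (+ n) b d _ _ _ _ _ _ (T′-rec n) T₁²≡S₁ T₀T₁≡bG₀ (G-rec n))

lemma4p1 : (b c : ℤ) (n : ℕ) →
    T n b c * T n b c ≡
      sumTo n (λ k → (+ ((n ℕ.+ k) C (2 ℕ.* k))) * ((+ ((2 ℕ.* k) C k)) ^ 2) * (c ^ k) * (disc b c ^ (n ℕ.∸ k)))
lemma4p1 b c n = begin
    T n b c * T n b c
  ≡⟨ cong₂ _*_ (T≡T′ n) (T≡T′ n) ⟩
    T′ n * T′ n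
  ≡⟨ proj₁ (invariant n) ⟩
    S n
  ≡⟨ sumTo-cong n (λ k _ → sym (ℤP.*-assoc (s n k) (c ^ k) (disc b c ^ (n ℕ.∸ k)))) ⟩
    sumTo n (λ k → s n k * c ^ k * disc b c ^ (n ℕ.∸ k)) ∎
  where open Recurrences b c
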